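{- For every represented space $\mathbf{X}$ and all problems $f,g$, we have $\mathrm{Det}_{\mathbf{X}}(f * g) \le_W \mathrm{Det}_{\mathbf{X}}(f) * g$.
   Context: A represented space is a set $X$ with a partial surjection $\delta_{\mathbf{X}} :\subseteq \mathbb{N}^{\mathbb{N}} \to X$; $p$ is a name of $x$ if $\delta_{\mathbf{X}}(p)=x$. A problem $f :\subseteq \mathbf{X} \rightrightarrows \mathbf{Y}$ is a partial multi-valued function. $f \le_W g$ means there are computable partial $\Phi,\Psi :\subseteq \mathbb{N}^{\mathbb{N}} \to \mathbb{N}^{\mathbb{N}}$ such that whenever $p$ names some $x\in\operatorname{dom}(f)$, $\Phi(p)$ names some $y\in\operatorname{dom}(g)$, and whenever $q$ names an element of $g(y)$, $\Psi(p,q)$ names an element of $f(x)$. The compositional product $f*g$ is a problem whose Weihrauch degree is the maximum of the degrees of $f_1 \circ g_1$ over all $f_1 \le_W f$, $g_1 \le_W g$ (this maximum exists). Let $\Phi_{(\cdot)}$ be a fixed universal Turing functional. The deterministic part $\mathrm{Det}_{\mathbf{X}}(f) :\subseteq \mathbb{N}^{\mathbb{N}} \times \mathbf{Y} \to \mathbf{X}$ of $f :\subseteq \mathbf{Y}\rightrightarrows\mathbf{Z}$ is defined by $\mathrm{Det}_{\mathbf{X}}(f)(p,y)=x$ iff for every name $z$ of every element of $f(y)$, $\delta_{\mathbf{X}}(\Phi_p(z))=x$, with maximal domain on which this is well-defined. -}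

module Defs where

open import Level using (0ℓ)
open import Data.Nat using (ℕ; zero; suc; _+_; _<_)
open import Data.Product using (Σ; ∃; ∃₂; _×_; _,_; proj₁; proj₂)
open import Relation.Binary.PropositionalEquality
  using (_≡_; refl; sym; trans; cong)
open import Relation.Binary using (Rel; IsEquivalence)

Baire : Set
Baire = ℕ → ℕ

_≗_ : Baire → Baire → Set
p ≗ q = ∀ n → p n ≡ q n

-- Interleaving ⟨p,q⟩ = p0 q0 p1 q1 ...
join : Baire → Baire → Baire
join p q zero    = p zero
join p q (suc n) = join q (λ k → p (suc k)) n

double : ℕ → ℕ
double zero    = zero
double (suc n) = suc (suc (double n))

π₁ : Baire → Baire
π₁ r n = r (double n)

π₂ : Baire → Baire
π₂ r n = r (suc (double n))

join-π₁ : ∀ p q → π₁ (join p q) ≗ p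
join-π₁ p q zero    = refl
join-π₁ p q (suc n) = join-π₁ (λ k → p (suc k)) (λ k → q (suc k)) n

join-π₂ : ∀ p q → π₂ (join p q) ≗ q
join-π₂ p q zero    = refl
join-π₂ p q (suc n) = join-π₂ (λ k → p (suc k)) (λ k → q (suc k)) n

join-ext : ∀ {p p' q q'} → p ≗ p' → q ≗ q' → join p q ≗ join p' q'
join-ext e e' zero    = e zero
join-ext e e' (suc n) = join-ext e' (λ k → e (suc k)) n

tri : ℕ → ℕ
tri zero    = zero
tri (suc n) = suc n + tri n

⟪_,_⟫ : ℕ → ℕ → ℕ
⟪ a , b ⟫ = tri (a + b) + b

-- A model of computation: oracle μ-recursive functions ℕ → ℕ
-- (with pairing), the standard model of type-2 computability.

data Code : Set where
  zer suc′ idc orc fstc sndc : Code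
  comp pairc rec : Code → Code → Code
  mu : Code → Code

data Eval : Code → Baire → ℕ → ℕ → Set where
  e-zer  : ∀ {α x} → Eval zer α x 0
  e-suc  : ∀ {α x} → Eval suc′ α x (suc x)
  e-id   : ∀ {α x} → Eval idc α x x
  e-orc  : ∀ {α x} → Eval orc α x (α x)
  e-fst  : ∀ {α a b x} → x ≡ ⟪ a , b ⟫ → Eval fstc α x a
  e-snd  : ∀ {α a b x} → x ≡ ⟪ a , b ⟫ → Eval sndc α x b
  e-comp : ∀ {f g α x y z} → Eval g α x y → Eval f α y z → Eval (comp f g) α x z
  e-pair : ∀ {f g α x a b y} → Eval f α x a → Eval g α x b → y ≡ ⟪ a , b ⟫
         → Eval (pairc f g) α x y
  e-rec0 : ∀ {f g α x y w} → w ≡ ⟪ x , 0 ⟫ → Eval f α x y → Eval (rec f g) α w y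
  e-recS : ∀ {f g α x n y z w} → w ≡ ⟪ x , suc n ⟫ → Eval (rec f g) α ⟪ x , n ⟫ y
         → Eval g α ⟪ x , ⟪ n , y ⟫ ⟫ z → Eval (rec f g) α w z
  e-mu   : ∀ {f α x n} → Eval f α ⟪ x , n ⟫ 0
         → (∀ m → m < n → ∃ λ k → Eval f α ⟪ x , m ⟫ (suc k))
         → Eval (mu f) α x n

⌜_⌝ : Code → ℕ
⌜ zer ⌝       = ⟪ 0 , 0 ⟫
⌜ suc′ ⌝      = ⟪ 1 , 0 ⟫
⌜ idc ⌝       = ⟪ 2 , 0 ⟫
⌜ orc ⌝       = ⟪ 3 , 0 ⟫
⌜ fstc ⌝      = ⟪ 4 , 0 ⟫
⌜ sndc ⌝      = ⟪ 5 , 0 ⟫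
⌜ comp f g ⌝  = ⟪ 6 , ⟪ ⌜ f ⌝ , ⌜ g ⌝ ⟫ ⟫
⌜ pairc f g ⌝ = ⟪ 7 , ⟪ ⌜ f ⌝ , ⌜ g ⌝ ⟫ ⟫
⌜ rec f g ⌝   = ⟪ 8 , ⟪ ⌜ f ⌝ , ⌜ g ⌝ ⟫ ⟫
⌜ mu f ⌝      = ⟪ 9 , ⌜ f ⌝ ⟫

-- Fixed universal Turing functional:  Φ_p(z)(n) = m  iff p 0 is the code
-- of a program c and c with oracle ⟨p,z⟩ on input n outputs m.
Univ : Baire → Baire → ℕ → ℕ → Set
Univ p z n m = ∃ λ c → ⌜ c ⌝ ≡ p 0 × Eval c (join p z) n m

-- Represented spaces (carrier a setoid, since ℕ → ℕ has no extensional
-- equality in Agda); Names p x  means  δ(p) = x.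

record RepSpace : Set₁ where
  field
    Carrier    : Set
    _≈_        : Rel Carrier 0ℓ
    ≈-equiv    : IsEquivalence _≈_
    Names      : Baire → Carrier → Set
    functional : ∀ {p x y} → Names p x → Names p y → x ≈ y
    surjective : ∀ x → ∃ λ p → Names p x
    names-ext  : ∀ {p q x} → p ≗ q → Names p x → Names q x
    names-resp : ∀ {p x y} → x ≈ y → Names p x → Names p y

open RepSpace public

BaireSpace : RepSpace
BaireSpace = record
  { Carrier    = Baire
  ; _≈_        = _≗_
  ; ≈-equiv    = record { refl = λ _ → refl
                        ; sym = λ e n → sym (e n)
                        ; trans = λ e e' n → trans (e n) (e' n) }
  ; Names      = _≗_
  ; functional = λ e e' n → trans (sym (e n)) (e' n)
  ; surjective = λ x → x , (λ _ → refl)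
  ; names-ext  = λ e e' n → trans (sym (e n)) (e' n)
  ; names-resp = λ e e' n → trans (e' n) (e n)
  }

_⊗_ : RepSpace → RepSpace → RepSpace
X ⊗ Y = record
  { Carrier    = Carrier X × Carrier Y
  ; _≈_        = λ a b → _≈_ X (proj₁ a) (proj₁ b) × _≈_ Y (proj₂ a) (proj₂ b)
  ; ≈-equiv    = record
      { refl  = IsEquivalence.refl (≈-equiv X) , IsEquivalence.refl (≈-equiv Y)
      ; sym   = λ e → IsEquivalence.sym (≈-equiv X) (proj₁ e)
                    , IsEquivalence.sym (≈-equiv Y) (proj₂ e)
      ; trans = λ e e' → IsEquivalence.trans (≈-equiv X) (proj₁ e) (proj₁ e')
                       , IsEquivalence.trans (≈-equiv Y) (proj₂ e) (proj₂ e') }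
  ; Names      = λ r a → Names X (π₁ r) (proj₁ a) × Names Y (π₂ r) (proj₂ a)
  ; functional = λ n n' → functional X (proj₁ n) (proj₁ n') , functional Y (proj₂ n) (proj₂ n')
  ; surjective = λ a →
      let (p , np) = surjective X (proj₁ a)
          (q , nq) = surjective Y (proj₂ a)
      in join p q , names-ext X (λ n → sym (join-π₁ p q n)) np
                  , names-ext Y (λ n → sym (join-π₂ p q n)) nq
  ; names-ext  = λ e n → names-ext X (λ k → e (double k)) (proj₁ n)
                       , names-ext Y (λ k → e (suc (double k))) (proj₂ n)
  ; names-resp = λ e n → names-resp X (proj₁ e) (proj₁ n) , names-resp Y (proj₂ e) (proj₂ n)
  }

record Problem (X Y : RepSpace) : Set₁ where
  field
    Dom      : Carrier X → Set
    Val      : Carrier X → Carrier Y → Set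
    nonempty : ∀ {x} → Dom x → ∃ λ y → Val x y
    dom-resp : ∀ {x x'} → _≈_ X x x' → Dom x → Dom x'
    val-resp : ∀ {x x' y y'} → _≈_ X x x' → _≈_ Y y y' → Val x y → Val x' y'

open Problem public

_∘ₚ_ : ∀ {X Y Z} → Problem Y Z → Problem X Y → Problem X Z
_∘ₚ_ {X} {Y} {Z} f g = record
  { Dom      = λ x → Dom g x × (∀ y → Val g x y → Dom f y)
  ; Val      = λ x z → ∃ λ y → Val g x y × Val f y z
  ; nonempty = λ { (dg , h) →
      let (y , gy) = nonempty g dg
          (z , fz) = nonempty f (h y gy)
      in z , y , gy , fz }
  ; dom-resp = λ e (dg , h) → dom-resp g e dg
      , λ y gy → h y (val-resp g (IsEquivalence.sym (≈-equiv X) e)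
                                  (IsEquivalence.refl (≈-equiv Y)) gy)
  ; val-resp = λ e e' (y , gy , fz) → y , val-resp g e (IsEquivalence.refl (≈-equiv Y)) gy
                                        , val-resp f (IsEquivalence.refl (≈-equiv Y)) e' fz
  }

Outputs : (X : RepSpace) → Code → Baire → Carrier X → Set
Outputs X c r x = ∃ λ s → (∀ n → Eval c r n (s n)) × Names X s x

_≤W_ : ∀ {A B C D} → Problem A B → Problem C D → Set
_≤W_ {A} {B} {C} {D} f g =
  ∃₂ λ (Φ Ψ : Code) → ∀ p x → Names A p x → Dom f x →
    ∃ λ y → Outputs C Φ p y × Dom g y ×
      (∀ q y' → Names D q y' → Val g y y' →
         ∃ λ x' → Outputs B Ψ (join p q) x' × Val f x x')

-- H represents the compositional product f * g: its degree is the
-- maximum of the degrees of f₁ ∘ g₁ with f₁ ≤W f, g₁ ≤W g.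
IsCompProd : ∀ {X Y Z W A B} → Problem X Y → Problem Z W → Problem A B → Set₁
IsCompProd f g H =
  (∀ {P Q R} (f₁ : Problem Q R) (g₁ : Problem P Q) →
      f₁ ≤W f → g₁ ≤W g → (f₁ ∘ₚ g₁) ≤W H)
  × (∃ λ P → ∃ λ Q → ∃ λ R → Σ (Problem Q R) λ f₁ → Σ (Problem P Q) λ g₁ →
      f₁ ≤W f × g₁ ≤W g × H ≤W (f₁ ∘ₚ g₁))

UnivNames : (X : RepSpace) → Baire → Baire → Carrier X → Set
UnivNames X p z x = ∃ λ s → (∀ n → Univ p z n (s n)) × Names X s x

DetVal : ∀ {Y Z} (X : RepSpace) → Problem Y Z → Baire → Carrier Y → Carrier X → Set
DetVal {Y} {Z} X f p y x =
  ∀ z → (∃ λ w → Val f y w × Names Z z w) → UnivNames X p z x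

Univ-ext : ∀ {p p' z n m} → p ≗ p' → Univ p z n m → Univ p' z n m
Univ-ext {p} {p'} {z} e (c , eq , ev) = c , trans eq (e 0) , Eval-ext ev
  where
  α≗ : join p z ≗ join p' z
  α≗ = join-ext e (λ _ → refl)
  Eval-ext : ∀ {c x y} → Eval c (join p z) x y → Eval c (join p' z) x y
  Eval-ext e-zer = e-zer
  Eval-ext e-suc = e-suc
  Eval-ext e-id = e-id
  Eval-ext {x = x} e-orc rewrite α≗ x = e-orc
  Eval-ext (e-fst q) = e-fst q
  Eval-ext (e-snd {a = a} q) = e-snd {a = a} q
  Eval-ext (e-comp a b) = e-comp (Eval-ext a) (Eval-ext b)
  Eval-ext (e-pair a b q) = e-pair (Eval-ext a) (Eval-ext b) q
  Eval-ext (e-rec0 q a) = e-rec0 q (Eval-ext a)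
  Eval-ext (e-recS {x = x} {n = n} {y = y} q a b) = e-recS {x = x} {n = n} {y = y} q (Eval-ext a) (Eval-ext b)
  Eval-ext (e-mu {x = x} {n = n} a h) = e-mu {x = x} {n = n} (Eval-ext a) (λ m lt → proj₁ (h m lt) , Eval-ext (proj₂ (h m lt)))

Det : ∀ {Y Z} (X : RepSpace) → Problem Y Z → Problem (BaireSpace ⊗ Y) X
Det {Y} {Z} X f = record
  { Dom      = λ a → Dom f (proj₂ a) × ∃ λ x → DetVal X f (proj₁ a) (proj₂ a) x
  ; Val      = λ a x → DetVal X f (proj₁ a) (proj₂ a) x
  ; nonempty = proj₂
  ; dom-resp = λ { (ep , ey) (df , x , dv) → dom-resp f ey df , x , tr ep ey (IsEquivalence.refl (≈-equiv X)) dv }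
  ; val-resp = λ { (ep , ey) ex dv → tr ep ey ex dv }
  }
  where
  tr : ∀ {p p' y y' x x'} → p ≗ p' → _≈_ Y y y' → _≈_ X x x'
     → DetVal X f p y x → DetVal X f p' y' x'
  tr ep ey ex dv z (w , fw , nz) =
    let (s , us , ns) = dv z (w , val-resp f (IsEquivalence.sym (≈-equiv Y) ey)
                                            (IsEquivalence.refl (≈-equiv Z)) fw , nz)
    in s , (λ n → Univ-ext ep (us n)) , names-resp X ex ns

-- Let f₁ ≤W f, g₁ ≤W g and H ≤W f₁ ∘ g₁ witness H ≤W f * g.  With one call to g, an instance
-- (p , a) of Det X H is translated into an instance (p' , y) of Det X f whose answers are answers
-- of (p , a): y is the f-instance produced along H → f₁ ∘ g₁, and p' is a program that, given a
-- name of an f-answer, runs the backward reductions to a name of an H-answer and applies p to it.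
-- Maximality of Det X f * g then bounds Det X f ∘ translation, which tightens Det X H.  The index
-- of p' must be computed from that of p; this is the computable map c ↦ c ∘ᶜ K on indices.
module Submission where

open import Defs
open import Data.Nat
open import Data.Nat.Properties
open import Data.Product
open import Data.Empty using (⊥; ⊥-elim)
open import Data.Unit using (⊤; tt)
open import Data.Sum using (_⊎_; inj₁; inj₂)
open import Data.List using (List; []; _∷_; length; lookup)
open import Data.List.Relation.Unary.All using (All; []; _∷_)
open import Data.Fin using (Fin; toℕ; #_)
open import Relation.Binary.PropositionalEquality hiding (_≗_)
open import Relation.Binary.Definitions using (tri<; tri≈; tri>)
open import Relation.Binary using (IsEquivalence)

pair-surjective : ∀ n → ∃₂ λ a b → n ≡ ⟪ a , b ⟫
pair-surjective zero = 0 , 0 , refl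
pair-surjective (suc n) with pair-surjective n
... | zero , b , refl = suc b , 0 , next-diagonal b
  where
  next-diagonal : ∀ b → suc ⟪ 0 , b ⟫ ≡ ⟪ suc b , 0 ⟫
  next-diagonal b rewrite +-identityʳ b | +-identityʳ (tri (suc b)) = cong suc (+-comm (tri b) b)
... | suc a , b , refl = a , suc b , same-diagonal a b
  where
  same-diagonal : ∀ a b → suc ⟪ suc a , b ⟫ ≡ ⟪ a , suc b ⟫
  same-diagonal a b rewrite +-suc a b | +-suc (tri (suc (a + b))) b = refl

tri-mono-≤ : ∀ {m n} → m ≤ n → tri m ≤ tri n
tri-mono-≤ {zero}  _         = z≤n
tri-mono-≤ {suc m} (s≤s m≤n) = +-mono-≤ (s≤s m≤n) (tri-mono-≤ m≤n)

pair-<-diagonal : ∀ {s s' b b'} → b ≤ s → s < s' → tri s + b < tri s' + b'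
pair-<-diagonal {s} {s'} {b} {b'} b≤s s<s' = begin-strict
  tri s + b        ≤⟨ +-monoʳ-≤ (tri s) b≤s ⟩
  tri s + s        <⟨ n<1+n _ ⟩
  suc (tri s + s)  ≡⟨ cong suc (+-comm (tri s) s) ⟩
  tri (suc s)      ≤⟨ tri-mono-≤ s<s' ⟩
  tri s'           ≤⟨ m≤m+n _ _ ⟩
  tri s' + b'      ∎
  where open ≤-Reasoning

pair-injective : ∀ {a b a' b'} → ⟪ a , b ⟫ ≡ ⟪ a' , b' ⟫ → a ≡ a' × b ≡ b'
pair-injective {a} {b} {a'} {b'} eq with <-cmp (a + b) (a' + b')
... | tri< lt _ _ = ⊥-elim (<-irrefl eq (pair-<-diagonal (m≤n+m b a) lt))
... | tri> _ _ gt = ⊥-elim (<-irrefl (sym eq) (pair-<-diagonal (m≤n+m b' a') gt))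
... | tri≈ _ a+b≡a'+b' _ = a≡a' , b≡b'
  where
  b≡b' : b ≡ b'
  b≡b' = +-cancelˡ-≡ (tri (a + b)) b b' (trans eq (cong (λ s → tri s + b') (sym a+b≡a'+b')))
  a≡a' : a ≡ a'
  a≡a' = +-cancelʳ-≡ b a a' (trans a+b≡a'+b' (cong (a' +_) (sym b≡b')))

opaque
  unpair : ℕ → ℕ × ℕ
  unpair n = let a , b , _ = pair-surjective n in a , b

  unpair-pair : ∀ a b → unpair ⟪ a , b ⟫ ≡ (a , b)
  unpair-pair a b with pair-surjective ⟪ a , b ⟫
  ... | a' , b' , eq with pair-injective {a} {b} {a'} {b'} eq
  ... | refl , refl = refl

Computes : Code → Baire → Baire → Set
Computes c α s = ∀ n → Eval c α n (s n)

computes-resp : ∀ {c α s t} → s ≗ t → Computes c α s → Computes c α t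
computes-resp {c} {α} s≗t cs n = subst (Eval c α n) (s≗t n) (cs n)

infixl 9 _∘ᶜ_
_∘ᶜ_ : Code → Code → Code
zer ∘ᶜ K = zer
suc′ ∘ᶜ K = suc′
idc ∘ᶜ K = idc
orc ∘ᶜ K = K
fstc ∘ᶜ K = fstc
sndc ∘ᶜ K = sndc
comp f g ∘ᶜ K = comp (f ∘ᶜ K) (g ∘ᶜ K)
pairc f g ∘ᶜ K = pairc (f ∘ᶜ K) (g ∘ᶜ K)
rec f g ∘ᶜ K = rec (f ∘ᶜ K) (g ∘ᶜ K)
mu f ∘ᶜ K = mu (f ∘ᶜ K)

∘ᶜ-eval : ∀ {c K α s x y} → Computes K α s → Eval c s x y → Eval (c ∘ᶜ K) α x y
∘ᶜ-eval K↦s e-zer = e-zer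
∘ᶜ-eval K↦s e-suc = e-suc
∘ᶜ-eval K↦s e-id = e-id
∘ᶜ-eval K↦s (e-orc {x = x}) = K↦s x
∘ᶜ-eval K↦s (e-fst eq) = e-fst eq
∘ᶜ-eval K↦s (e-snd {a = a} eq) = e-snd {a = a} eq
∘ᶜ-eval K↦s (e-comp d d') = e-comp (∘ᶜ-eval K↦s d) (∘ᶜ-eval K↦s d')
∘ᶜ-eval K↦s (e-pair d d' eq) = e-pair (∘ᶜ-eval K↦s d) (∘ᶜ-eval K↦s d') eq
∘ᶜ-eval K↦s (e-rec0 eq d) = e-rec0 eq (∘ᶜ-eval K↦s d)
∘ᶜ-eval K↦s (e-recS {x = x} {n = n} {y = y} eq d d') =
  e-recS {x = x} {n = n} {y = y} eq (∘ᶜ-eval K↦s d) (∘ᶜ-eval K↦s d')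
∘ᶜ-eval K↦s (e-mu {x = x} {n = n} d below) =
  e-mu {x = x} {n = n} (∘ᶜ-eval K↦s d) (λ m m<n → map₂ (∘ᶜ-eval K↦s) (below m m<n))

computes-∘ᶜ : ∀ {c K α s t} → Computes K α s → Computes c s t → Computes (c ∘ᶜ K) α t
computes-∘ᶜ K↦s c↦t n = ∘ᶜ-eval K↦s (c↦t n)

eval-deterministic : ∀ {c α x y y'} → Eval c α x y → Eval c α x y' → y ≡ y'
eval-deterministic e-zer e-zer = refl
eval-deterministic e-suc e-suc = refl
eval-deterministic e-id e-id = refl
eval-deterministic e-orc e-orc = refl
eval-deterministic (e-fst {a = a} {b} eq) (e-fst {a = a'} {b'} eq') =
  proj₁ (pair-injective {a} {b} {a'} {b'} (trans (sym eq) eq'))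
eval-deterministic (e-snd {a = a} {b} eq) (e-snd {a = a'} {b'} eq') =
  proj₂ (pair-injective {a} {b} {a'} {b'} (trans (sym eq) eq'))
eval-deterministic (e-comp d₁ d₂) (e-comp d₁' d₂') with eval-deterministic d₁ d₁'
... | refl = eval-deterministic d₂ d₂'
eval-deterministic (e-pair d₁ d₂ eq) (e-pair d₁' d₂' eq')
  with eval-deterministic d₁ d₁' | eval-deterministic d₂ d₂'
... | refl | refl = trans eq (sym eq')
eval-deterministic (e-rec0 {x = x} eq d) (e-rec0 {x = x'} eq' d')
  with pair-injective {x} {0} {x'} {0} (trans (sym eq) eq')
... | refl , _ = eval-deterministic d d'
eval-deterministic (e-rec0 {x = x} eq _) (e-recS {x = x'} {n = n'} eq' _ _)
  with pair-injective {x} {0} {x'} {suc n'} (trans (sym eq) eq')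
... | _ , ()
eval-deterministic (e-recS {x = x} {n = n} eq _ _) (e-rec0 {x = x'} eq' _)
  with pair-injective {x} {suc n} {x'} {0} (trans (sym eq) eq')
... | _ , ()
eval-deterministic (e-recS {x = x} {n = n} eq d₁ d₂) (e-recS {x = x'} {n = n'} eq' d₁' d₂')
  with pair-injective {x} {suc n} {x'} {suc n'} (trans (sym eq) eq')
... | refl , refl with eval-deterministic d₁ d₁'
... | refl = eval-deterministic d₂ d₂'
eval-deterministic (e-mu {n = n} d below) (e-mu {n = n'} d' below') with <-cmp n n'
... | tri< n<n' _ _ = ⊥-elim (0≢1+n (eval-deterministic d (proj₂ (below' n n<n'))))
... | tri≈ _ n≡n' _ = n≡n'
... | tri> _ _ n'<n = ⊥-elim (0≢1+n (eval-deterministic d' (proj₂ (below n' n'<n))))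

decode : ℕ → ℕ → Code
decode zero    _ = zer
decode (suc k) n = decodeNode (unpair n)
  where
  decodeChildren : (Code → Code → Code) → ℕ → Code
  decodeChildren node a = node (decode k (proj₁ (unpair a))) (decode k (proj₂ (unpair a)))
  decodeNode : ℕ × ℕ → Code
  decodeNode (0 , _) = zer
  decodeNode (1 , _) = suc′
  decodeNode (2 , _) = idc
  decodeNode (3 , _) = orc
  decodeNode (4 , _) = fstc
  decodeNode (5 , _) = sndc
  decodeNode (6 , a) = decodeChildren comp a
  decodeNode (7 , a) = decodeChildren pairc a
  decodeNode (8 , a) = decodeChildren rec a
  decodeNode (9 , a) = mu (decode k a)
  decodeNode _       = zer

depth : Code → ℕ
depth (comp f g)  = suc (depth f ⊔ depth g)
depth (pairc f g) = suc (depth f ⊔ depth g)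
depth (rec f g)   = suc (depth f ⊔ depth g)
depth (mu f)      = suc (depth f)
depth _           = 0

decode-index : ∀ c {k} → depth c < k → decode k ⌜ c ⌝ ≡ c
decode-index zer    {suc k} _ rewrite unpair-pair 0 0 = refl
decode-index suc′   {suc k} _ rewrite unpair-pair 1 0 = refl
decode-index idc    {suc k} _ rewrite unpair-pair 2 0 = refl
decode-index orc    {suc k} _ rewrite unpair-pair 3 0 = refl
decode-index fstc   {suc k} _ rewrite unpair-pair 4 0 = refl
decode-index sndc   {suc k} _ rewrite unpair-pair 5 0 = refl
decode-index (comp f g) {suc k} (s≤s d<k)
  rewrite unpair-pair 6 ⟪ ⌜ f ⌝ , ⌜ g ⌝ ⟫ | unpair-pair ⌜ f ⌝ ⌜ g ⌝ =
  cong₂ comp (decode-index f (m⊔n<o⇒m<o _ _ d<k)) (decode-index g (m⊔n<o⇒n<o _ _ d<k))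
decode-index (pairc f g) {suc k} (s≤s d<k)
  rewrite unpair-pair 7 ⟪ ⌜ f ⌝ , ⌜ g ⌝ ⟫ | unpair-pair ⌜ f ⌝ ⌜ g ⌝ =
  cong₂ pairc (decode-index f (m⊔n<o⇒m<o _ _ d<k)) (decode-index g (m⊔n<o⇒n<o _ _ d<k))
decode-index (rec f g) {suc k} (s≤s d<k)
  rewrite unpair-pair 8 ⟪ ⌜ f ⌝ , ⌜ g ⌝ ⟫ | unpair-pair ⌜ f ⌝ ⌜ g ⌝ =
  cong₂ rec (decode-index f (m⊔n<o⇒m<o _ _ d<k)) (decode-index g (m⊔n<o⇒n<o _ _ d<k))
decode-index (mu f) {suc k} (s≤s d<k) rewrite unpair-pair 9 ⌜ f ⌝ = cong mu (decode-index f d<k)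

⌜⌝-injective : ∀ {c d} → ⌜ c ⌝ ≡ ⌜ d ⌝ → c ≡ d
⌜⌝-injective {c} {d} eq = begin
  c                ≡⟨ sym (decode-index c (s≤s (m≤m+n (depth c) (depth d)))) ⟩
  decode k ⌜ c ⌝   ≡⟨ cong (decode k) eq ⟩
  decode k ⌜ d ⌝   ≡⟨ decode-index d (s≤s (m≤n+m (depth d) (depth c))) ⟩
  d                ∎
  where
  open ≡-Reasoning
  k : ℕ
  k = suc (depth c + depth d)

univ-deterministic : ∀ {p z n m m'} → Univ p z n m → Univ p z n m' → m ≡ m'
univ-deterministic (c , ⌜c⌝≡p0 , d) (c' , ⌜c'⌝≡p0 , d')
  with ⌜⌝-injective {c} {c'} (trans ⌜c⌝≡p0 (sym ⌜c'⌝≡p0))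
... | refl = eval-deterministic d d'

fst-eval : ∀ {α} a b → Eval fstc α ⟪ a , b ⟫ a
fst-eval a b = e-fst {b = b} refl

snd-eval : ∀ {α} a b → Eval sndc α ⟪ a , b ⟫ b
snd-eval a b = e-snd {a = a} refl

pair-eval : ∀ {f g α x a b} → Eval f α x a → Eval g α x b → Eval (pairc f g) α x ⟪ a , b ⟫
pair-eval d d' = e-pair d d' refl

rec-zero : ∀ x {f g α y} → Eval f α x y → Eval (rec f g) α ⟪ x , 0 ⟫ y
rec-zero x d = e-rec0 {x = x} refl d

rec-suc : ∀ x n {f g α y z} → Eval (rec f g) α ⟪ x , n ⟫ y → Eval g α ⟪ x , ⟪ n , y ⟫ ⟫ z
        → Eval (rec f g) α ⟪ x , suc n ⟫ z
rec-suc x n {y = y} d d' = e-recS {x = x} {n = n} {y = y} refl d d'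

Halts : Code → Baire → ℕ → Set
Halts c α x = ∃ λ y → Eval c α x y

Total : Code → Set
Total c = ∀ α x → Halts c α x

rec-halts : ∀ {f g α x} → Halts f α x → Total g → ∀ n → Halts (rec f g) α ⟪ x , n ⟫
rec-halts {x = x} (y , d) g-total zero = y , rec-zero x d
rec-halts {α = α} {x} f-halts g-total (suc n) =
  let y , d  = rec-halts f-halts g-total n
      z , d' = g-total α ⟪ x , ⟪ n , y ⟫ ⟫
  in z , rec-suc x n d d'

PrimRec : Code → Set
PrimRec (comp f g)  = PrimRec f × PrimRec g
PrimRec (pairc f g) = PrimRec f × PrimRec g
PrimRec (rec f g)   = PrimRec f × PrimRec g
PrimRec (mu f)      = ⊥
PrimRec _           = ⊤

primRec-total : ∀ c → PrimRec c → Total c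
primRec-total zer  _ α x = 0 , e-zer
primRec-total suc′ _ α x = suc x , e-suc
primRec-total idc  _ α x = x , e-id
primRec-total orc  _ α x = α x , e-orc
primRec-total fstc _ α x = let a , b , x≡ab = pair-surjective x in a , e-fst x≡ab
primRec-total sndc _ α x = let a , b , x≡ab = pair-surjective x in b , e-snd {a = a} x≡ab
primRec-total (comp f g) (pf , pg) α x =
  let y , d  = primRec-total g pg α x
      z , d' = primRec-total f pf α y
  in z , e-comp d d'
primRec-total (pairc f g) (pf , pg) α x =
  let a , d  = primRec-total f pf α x
      b , d' = primRec-total g pg α x
  in ⟪ a , b ⟫ , pair-eval d d'
primRec-total (rec f g) (pf , pg) α w =
  let x , n , w≡xn = pair-surjective w
      y , d        = rec-halts (primRec-total f pf α x) (primRec-total g pg) n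
  in y , subst (λ w → Eval (rec f g) α w y) (sym w≡xn) d

comp-total : ∀ {f g} → Total f → Total g → Total (comp f g)
comp-total f-total g-total α x =
  let y , d  = g-total α x
      z , d' = f-total α y
  in z , e-comp d d'

dropResultᶜ : Code
dropResultᶜ = pairc fstc (comp fstc sndc)

-- cases A B runs A on x for ⟪ x , 0 ⟫ and B on ⟪ x , m ⟫ for ⟪ x , suc m ⟫.
cases : Code → Code → Code
cases A B = rec A (comp B dropResultᶜ)

cases-zero : ∀ x {A B α y} → Eval A α x y → Eval (cases A B) α ⟪ x , 0 ⟫ y
cases-zero x d = rec-zero x d

cases-step : ∀ x m y {B α z} → Eval B α ⟪ x , m ⟫ z
           → Eval (comp B dropResultᶜ) α ⟪ x , ⟪ m , y ⟫ ⟫ z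
cases-step x m y d =
  e-comp (pair-eval (fst-eval x ⟪ m , y ⟫) (e-comp (snd-eval x ⟪ m , y ⟫) (fst-eval m y))) d

cases-one : ∀ x {A B α y z} → Eval A α x y → Eval B α ⟪ x , 0 ⟫ z → Eval (cases A B) α ⟪ x , 1 ⟫ z
cases-one x {y = y} d d' = rec-suc x 0 (rec-zero x d) (cases-step x 0 y d')

cases-suc : ∀ x m {A B α z} → Halts A α x → Total B → Eval B α ⟪ x , m ⟫ z
          → Eval (cases A B) α ⟪ x , suc m ⟫ z
cases-suc x m A-halts B-total d =
  let y , d-m = rec-halts A-halts (comp-total B-total (primRec-total _ _)) m
  in rec-suc x m d-m (cases-step x m y d)

switch : List Code → Code
switch []       = zer
switch (c ∷ cs) = cases c (switch cs)

switch-primRec : ∀ {cs} → All PrimRec cs → PrimRec (switch cs)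
switch-primRec []             = tt
switch-primRec (c-pr ∷ cs-pr) = c-pr , switch-primRec cs-pr , _

switch-eval : ∀ {cs α} e {o} → All PrimRec cs → (i : Fin (length cs))
            → Eval (lookup cs i) α e o → Eval (switch cs) α ⟪ e , toℕ i ⟫ o
switch-eval e (_ ∷ _) Fin.zero d = cases-zero e d
switch-eval {c ∷ cs} e (c-pr ∷ cs-pr) (Fin.suc i) d = cases-suc e (toℕ i)
  (primRec-total c c-pr _ e) (primRec-total (switch cs) (switch-primRec cs-pr)) (switch-eval e cs-pr i d)

numᶜ : ℕ → Code
numᶜ zero    = zer
numᶜ (suc k) = comp suc′ (numᶜ k)

numᶜ-eval : ∀ k {α x} → Eval (numᶜ k) α x k
numᶜ-eval zero    = e-zer
numᶜ-eval (suc k) = e-comp (numᶜ-eval k) e-suc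

numᶜ-primRec : ∀ k → PrimRec (numᶜ k)
numᶜ-primRec zero    = tt
numᶜ-primRec (suc k) = tt , numᶜ-primRec k

predᶜ : Code
predᶜ = comp (cases zer sndc) (pairc zer idc)

predᶜ-eval : ∀ {α} m → Eval predᶜ α (suc m) m
predᶜ-eval m = e-comp (pair-eval e-zer e-id) (cases-suc 0 m (0 , e-zer) (primRec-total sndc _) (snd-eval 0 m))

doubleᶜ : Code
doubleᶜ = comp (rec zer (comp suc′ (comp suc′ (comp sndc sndc)))) (pairc zer idc)

doubleᶜ-eval : ∀ {α} n → Eval doubleᶜ α n (double n)
doubleᶜ-eval n = e-comp (pair-eval e-zer e-id) (iterate n)
  where
  iterate : ∀ {α} n → Eval (rec zer (comp suc′ (comp suc′ (comp sndc sndc)))) α ⟪ 0 , n ⟫ (double n)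
  iterate zero    = rec-zero 0 e-zer
  iterate (suc n) = rec-suc 0 n (iterate n)
    (e-comp (e-comp (e-comp (snd-eval 0 ⟪ n , double n ⟫) (snd-eval n (double n))) e-suc) e-suc)

π₁ᶜ π₂ᶜ tailᶜ : Code
π₁ᶜ   = comp orc doubleᶜ
π₂ᶜ   = comp orc (comp suc′ doubleᶜ)
tailᶜ = comp orc suc′

π₁ᶜ-computes : ∀ α → Computes π₁ᶜ α (π₁ α)
π₁ᶜ-computes α n = e-comp (doubleᶜ-eval n) e-orc

π₂ᶜ-computes : ∀ α → Computes π₂ᶜ α (π₂ α)
π₂ᶜ-computes α n = e-comp (e-comp (doubleᶜ-eval n) e-suc) e-orc

π₁ᶜ-join : ∀ a b → Computes π₁ᶜ (join a b) a
π₁ᶜ-join a b = computes-resp (join-π₁ a b) (π₁ᶜ-computes (join a b))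

π₂ᶜ-join : ∀ a b → Computes π₂ᶜ (join a b) b
π₂ᶜ-join a b = computes-resp (join-π₂ a b) (π₂ᶜ-computes (join a b))

tailᶜ-computes : ∀ α → Computes tailᶜ α (λ n → α (suc n))
tailᶜ-computes α n = e-comp e-suc e-orc

flipᶜ halveRecᶜ halveᶜ : Code
flipᶜ    = cases (pairc idc (numᶜ 1)) (pairc (comp suc′ fstc) zer)
halveRecᶜ = rec (pairc zer zer) (comp flipᶜ (comp sndc sndc))
halveᶜ   = comp halveRecᶜ (pairc zer idc)

halveRecᶜ-even : ∀ {α} k → Eval halveRecᶜ α ⟪ 0 , double k ⟫ ⟪ k , 0 ⟫
halveRecᶜ-odd  : ∀ {α} k → Eval halveRecᶜ α ⟪ 0 , suc (double k) ⟫ ⟪ k , 1 ⟫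
halveRecᶜ-even zero    = rec-zero 0 (pair-eval e-zer e-zer)
halveRecᶜ-even (suc k) = rec-suc 0 (suc (double k)) (halveRecᶜ-odd k)
  (e-comp (e-comp (snd-eval 0 ⟪ suc (double k) , ⟪ k , 1 ⟫ ⟫) (snd-eval (suc (double k)) ⟪ k , 1 ⟫))
          (cases-one k (pair-eval e-id (numᶜ-eval 1)) (pair-eval (e-comp (fst-eval k 0) e-suc) e-zer)))
halveRecᶜ-odd k = rec-suc 0 (double k) (halveRecᶜ-even k)
  (e-comp (e-comp (snd-eval 0 ⟪ double k , ⟪ k , 0 ⟫ ⟫) (snd-eval (double k) ⟪ k , 0 ⟫))
          (cases-zero k (pair-eval e-id (numᶜ-eval 1))))

even-or-odd : ∀ n → ∃ λ k → n ≡ double k ⊎ n ≡ suc (double k)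
even-or-odd zero = 0 , inj₁ refl
even-or-odd (suc n) with even-or-odd n
... | k , inj₁ n≡2k   = k , inj₂ (cong suc n≡2k)
... | k , inj₂ n≡2k+1 = suc k , inj₁ (cong suc n≡2k+1)

joinᶜ : Code → Code → Code
joinᶜ A B = comp (cases A (comp B fstc)) halveᶜ

joinᶜ-computes : ∀ {A B α a b} → Computes A α a → Computes B α b → Computes (joinᶜ A B) α (join a b)
joinᶜ-computes {A} {B} {α} {a} {b} A↦a B↦b n with even-or-odd n
... | k , inj₁ refl = subst (Eval (joinᶜ A B) α (double k)) (sym (join-π₁ a b k))
  (e-comp (e-comp (pair-eval e-zer e-id) (halveRecᶜ-even k)) (cases-zero k (A↦a k)))
... | k , inj₂ refl = subst (Eval (joinᶜ A B) α (suc (double k))) (sym (join-π₂ a b k))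
  (e-comp (e-comp (pair-eval e-zer e-id) (halveRecᶜ-odd k)) (cases-one k (A↦a k) (e-comp (fst-eval k 0) (B↦b k))))

prepend : ℕ → Baire → Baire
prepend σ α zero    = σ
prepend σ α (suc n) = α n

prependᶜ : Code → Code
prependᶜ A = comp (cases (comp A orc) (comp orc sndc)) (pairc zer idc)

prependᶜ-computes : ∀ {A α σ} → Eval A α (α 0) σ → Computes (prependᶜ A) α (prepend σ α)
prependᶜ-computes A↦σ zero    = e-comp (pair-eval e-zer e-id) (cases-zero 0 (e-comp e-orc A↦σ))
prependᶜ-computes A↦σ (suc m) = e-comp (pair-eval e-zer e-id)
  (cases-suc 0 m (_ , e-comp e-orc A↦σ) (primRec-total (comp orc sndc) _) (e-comp (snd-eval 0 m) e-orc))

-- Being structural recursion on codes, ⌜ c ⌝ ↦ ⌜ c ∘ᶜ K ⌝ is computed by a stack machine run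
-- until its stack empties, the number of steps being found by μ.  A state ⟪ S , R ⟫ holds a stack
-- S of pending tasks and a stack R of finished indices; 0 is the empty stack.  Tasks are ⟪ 0 , n ⟫
-- (translate the program with index n) and ⟪ 1 , t ⟫, ⟪ 2 , 0 ⟫ (rebuild a node with tag t, resp.
-- a μ-node, from the top results).
module ComposeIndex (K : Code) where

  infixr 5 _∷ₙ_
  _∷ₙ_ : ℕ → ℕ → ℕ
  a ∷ₙ l = suc ⟪ a , l ⟫

  consᶜ : Code → Code → Code
  consᶜ A B = comp suc′ (pairc A B)

  consᶜ-eval : ∀ {A B α x a l} → Eval A α x a → Eval B α x l → Eval (consᶜ A B) α x (a ∷ₙ l)
  consᶜ-eval d d' = e-comp (pair-eval d d') e-suc

  visit assemble : ℕ → ℕ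
  visit n    = ⟪ 0 , n ⟫
  assemble t = ⟪ 1 , t ⟫

  assembleμ : ℕ
  assembleμ = ⟪ 2 , 0 ⟫

  -- Task handlers act on ⟪ n , ⟪ S , R ⟫ ⟫, n being the argument of the popped task.
  argᶜ stackᶜ resultsᶜ : Code
  argᶜ     = fstc
  stackᶜ   = comp fstc sndc
  resultsᶜ = comp sndc sndc

  module _ {α : Baire} (n S R : ℕ) where
    arg-eval : Eval argᶜ α ⟪ n , ⟪ S , R ⟫ ⟫ n
    arg-eval = fst-eval n ⟪ S , R ⟫

    stack-eval : Eval stackᶜ α ⟪ n , ⟪ S , R ⟫ ⟫ S
    stack-eval = e-comp (snd-eval n ⟪ S , R ⟫) (fst-eval S R)

    results-eval : Eval resultsᶜ α ⟪ n , ⟪ S , R ⟫ ⟫ R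
    results-eval = e-comp (snd-eval n ⟪ S , R ⟫) (snd-eval S R)

  keepᶜ oracleᶜ splitᶜ splitμᶜ : Code
  keepᶜ   = pairc stackᶜ (consᶜ argᶜ resultsᶜ)
  oracleᶜ = pairc stackᶜ (consᶜ (numᶜ ⌜ K ⌝) resultsᶜ)
  splitᶜ  = pairc (consᶜ (pairc zer (comp fstc (comp sndc argᶜ)))
                    (consᶜ (pairc zer (comp sndc (comp sndc argᶜ)))
                      (consᶜ (pairc (numᶜ 1) (comp fstc argᶜ)) stackᶜ)))
                  resultsᶜ
  splitμᶜ = pairc (consᶜ (pairc zer (comp sndc argᶜ)) (consᶜ (pairc (numᶜ 2) zer) stackᶜ)) resultsᶜ

  keep-eval : ∀ {α} n S R → Eval keepᶜ α ⟪ n , ⟪ S , R ⟫ ⟫ ⟪ S , n ∷ₙ R ⟫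
  keep-eval n S R = pair-eval (stack-eval n S R) (consᶜ-eval (arg-eval n S R) (results-eval n S R))

  oracle-eval : ∀ {α} n S R → Eval oracleᶜ α ⟪ n , ⟪ S , R ⟫ ⟫ ⟪ S , ⌜ K ⌝ ∷ₙ R ⟫
  oracle-eval n S R = pair-eval (stack-eval n S R) (consᶜ-eval (numᶜ-eval ⌜ K ⌝) (results-eval n S R))

  split-eval : ∀ {α} t a b S R → Eval splitᶜ α ⟪ ⟪ t , ⟪ a , b ⟫ ⟫ , ⟪ S , R ⟫ ⟫
                                   ⟪ visit a ∷ₙ visit b ∷ₙ assemble t ∷ₙ S , R ⟫
  split-eval t a b S R =
    pair-eval (consᶜ-eval (pair-eval e-zer (e-comp children (fst-eval a b)))
                (consᶜ-eval (pair-eval e-zer (e-comp children (snd-eval a b)))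
                  (consᶜ-eval (pair-eval (numᶜ-eval 1) (e-comp (arg-eval n S R) (fst-eval t ⟪ a , b ⟫)))
                    (stack-eval n S R))))
              (results-eval n S R)
    where
    n = ⟪ t , ⟪ a , b ⟫ ⟫
    children = e-comp (arg-eval n S R) (snd-eval t ⟪ a , b ⟫)

  splitμ-eval : ∀ {α} a S R → Eval splitμᶜ α ⟪ ⟪ 9 , a ⟫ , ⟪ S , R ⟫ ⟫ ⟪ visit a ∷ₙ assembleμ ∷ₙ S , R ⟫
  splitμ-eval a S R =
    pair-eval (consᶜ-eval (pair-eval e-zer (e-comp (arg-eval n S R) (snd-eval 9 a)))
                (consᶜ-eval (pair-eval (numᶜ-eval 2) e-zer) (stack-eval n S R)))
              (results-eval n S R)
    where n = ⟪ 9 , a ⟫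

  -- Indexed by the tag of the program being visited; tags 0–5 are the atomic programs.
  visitHandlers : List Code
  visitHandlers = keepᶜ ∷ keepᶜ ∷ keepᶜ ∷ oracleᶜ ∷ keepᶜ ∷ keepᶜ ∷ splitᶜ ∷ splitᶜ ∷ splitᶜ ∷ splitμᶜ ∷ []

  visitHandlers-primRec : All PrimRec visitHandlers
  visitHandlers-primRec = _ ∷ _ ∷ _ ∷ oracle-primRec ∷ _ ∷ _ ∷ _ ∷ _ ∷ _ ∷ _ ∷ []
    where
    oracle-primRec : PrimRec oracleᶜ
    oracle-primRec = _ , _ , numᶜ-primRec ⌜ K ⌝ , _

  visitᶜ : Code
  visitᶜ = comp (switch visitHandlers) (pairc idc (comp fstc argᶜ))

  visitᶜ-eval : ∀ {α} (i : Fin 10) x S R {o} → Eval (lookup visitHandlers i) α ⟪ ⟪ toℕ i , x ⟫ , ⟪ S , R ⟫ ⟫ o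
              → Eval visitᶜ α ⟪ ⟪ toℕ i , x ⟫ , ⟪ S , R ⟫ ⟫ o
  visitᶜ-eval i x S R d =
    e-comp (pair-eval e-id (e-comp (arg-eval ⟪ toℕ i , x ⟫ S R) (fst-eval (toℕ i) x)))
           (switch-eval _ visitHandlers-primRec i d)

  secondᶜ restᶜ : Code
  secondᶜ = comp predᶜ resultsᶜ
  restᶜ   = comp predᶜ (comp sndc secondᶜ)

  assembleᶜ assembleμᶜ : Code
  assembleᶜ  = pairc stackᶜ
                 (consᶜ (pairc argᶜ (pairc (comp fstc restᶜ) (comp fstc secondᶜ))) (comp sndc restᶜ))
  assembleμᶜ = pairc stackᶜ (consᶜ (pairc (numᶜ 9) (comp fstc secondᶜ)) (comp sndc secondᶜ))

  assemble-eval : ∀ {α} t S a b R → Eval assembleᶜ α ⟪ t , ⟪ S , b ∷ₙ a ∷ₙ R ⟫ ⟫ ⟪ S , ⟪ t , ⟪ a , b ⟫ ⟫ ∷ₙ R ⟫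
  assemble-eval t S a b R =
    pair-eval (stack-eval t S R₂)
      (consᶜ-eval (pair-eval (arg-eval t S R₂)
                             (pair-eval (e-comp rest (fst-eval a R)) (e-comp second (fst-eval b R₁))))
                  (e-comp rest (snd-eval a R)))
    where
    R₁ = a ∷ₙ R
    R₂ = b ∷ₙ R₁
    second = e-comp (results-eval t S R₂) (predᶜ-eval ⟪ b , R₁ ⟫)
    rest   = e-comp (e-comp second (snd-eval b R₁)) (predᶜ-eval ⟪ a , R ⟫)

  assembleμ-eval : ∀ {α} S a R → Eval assembleμᶜ α ⟪ 0 , ⟪ S , a ∷ₙ R ⟫ ⟫ ⟪ S , ⟪ 9 , a ⟫ ∷ₙ R ⟫
  assembleμ-eval S a R =
    pair-eval (stack-eval 0 S R₁)
      (consᶜ-eval (pair-eval (numᶜ-eval 9) (e-comp second (fst-eval a R))) (e-comp second (snd-eval a R)))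
    where
    R₁ = a ∷ₙ R
    second = e-comp (results-eval 0 S R₁) (predᶜ-eval ⟪ a , R ⟫)

  taskHandlers : List Code
  taskHandlers = visitᶜ ∷ assembleᶜ ∷ assembleμᶜ ∷ []

  taskHandlers-primRec : All PrimRec taskHandlers
  taskHandlers-primRec = (switch-primRec visitHandlers-primRec , _) ∷ _ ∷ _ ∷ []

  unpackᶜ : Code
  unpackᶜ = pairc (pairc (comp sndc (comp fstc sndc)) (pairc (comp sndc sndc) (comp sndc fstc)))
                  (comp fstc (comp fstc sndc))

  unpack-eval : ∀ {α} S R k n S' → Eval unpackᶜ α ⟪ ⟪ S , R ⟫ , ⟪ ⟪ k , n ⟫ , S' ⟫ ⟫ ⟪ ⟪ n , ⟪ S' , R ⟫ ⟫ , k ⟫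
  unpack-eval S R k n S' =
    pair-eval (pair-eval (e-comp (e-comp popped (fst-eval task S')) (snd-eval k n))
                         (pair-eval (e-comp popped (snd-eval task S')) (e-comp (fst-eval state _) (snd-eval S R))))
              (e-comp (e-comp popped (fst-eval task S')) (fst-eval k n))
    where
    task = ⟪ k , n ⟫
    state = ⟪ S , R ⟫
    popped = snd-eval state ⟪ task , S' ⟫

  dispatchᶜ : Code
  dispatchᶜ = comp (switch taskHandlers) unpackᶜ

  stepᶜ : Code
  stepᶜ = comp (cases idc dispatchᶜ) (pairc idc fstc)

  step-eval : ∀ {α} (i : Fin 3) n S R {o} → Eval (lookup taskHandlers i) α ⟪ n , ⟪ S , R ⟫ ⟫ o
            → Eval stepᶜ α ⟪ ⟪ toℕ i , n ⟫ ∷ₙ S , R ⟫ o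
  step-eval i n S R d =
    e-comp (pair-eval e-id (fst-eval (task ∷ₙ S) R))
      (cases-suc ⟪ task ∷ₙ S , R ⟫ ⟪ task , S ⟫ (_ , e-id) dispatch-total
        (e-comp (unpack-eval (task ∷ₙ S) R (toℕ i) n S) (switch-eval ⟪ n , ⟪ S , R ⟫ ⟫ taskHandlers-primRec i d)))
    where
    task = ⟪ toℕ i , n ⟫
    dispatch-total : Total dispatchᶜ
    dispatch-total = comp-total (primRec-total _ (switch-primRec taskHandlers-primRec)) (primRec-total _ _)

  step-visit : ∀ {α} (i : Fin 10) x S R {o} → Eval (lookup visitHandlers i) α ⟪ ⟪ toℕ i , x ⟫ , ⟪ S , R ⟫ ⟫ o
             → Eval stepᶜ α ⟪ visit ⟪ toℕ i , x ⟫ ∷ₙ S , R ⟫ o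
  step-visit i x S R d = step-eval (# 0) ⟪ toℕ i , x ⟫ S R (visitᶜ-eval i x S R d)

  step-assemble : ∀ {α} t S a b R
                → Eval stepᶜ α ⟪ assemble t ∷ₙ S , b ∷ₙ a ∷ₙ R ⟫ ⟪ S , ⟪ t , ⟪ a , b ⟫ ⟫ ∷ₙ R ⟫
  step-assemble t S a b R = step-eval (# 1) t S _ (assemble-eval t S a b R)

  step-assembleμ : ∀ {α} S a R → Eval stepᶜ α ⟪ assembleμ ∷ₙ S , a ∷ₙ R ⟫ ⟪ S , ⟪ 9 , a ⟫ ∷ₙ R ⟫
  step-assembleμ S a R = step-eval (# 2) 0 S _ (assembleμ-eval S a R)

  data Run (α : Baire) : ℕ → ℕ → ℕ → ℕ → ℕ → Set where
    done : ∀ {S R} → Run α S R 0 S R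
    step : ∀ {T R S₁ R₁ k S' R'} → Eval stepᶜ α ⟪ suc T , R ⟫ ⟪ S₁ , R₁ ⟫ → Run α S₁ R₁ k S' R'
         → Run α (suc T) R (suc k) S' R'

  _▷_ : ∀ {α S R k S' R' k' S'' R''} → Run α S R k S' R' → Run α S' R' k' S'' R'' → Run α S R (k + k') S'' R''
  done       ▷ r' = r'
  step d r   ▷ r' = step d (r ▷ r')
  infixr 5 _▷_

  stepCount : Code → ℕ
  stepCount (comp f g)  = suc (stepCount f + (stepCount g + 1))
  stepCount (pairc f g) = suc (stepCount f + (stepCount g + 1))
  stepCount (rec f g)   = suc (stepCount f + (stepCount g + 1))
  stepCount (mu f)      = suc (stepCount f + 1)
  stepCount _           = 1

  Compiles : Baire → Code → Set
  Compiles α c = ∀ S R → Run α (visit ⌜ c ⌝ ∷ₙ S) R (stepCount c) S (⌜ c ∘ᶜ K ⌝ ∷ₙ R)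

  handledBy : ∀ {α i e o h} → lookup visitHandlers i ≡ h → Eval h α e o → Eval (lookup visitHandlers i) α e o
  handledBy refl d = d

  run-atom : ∀ {α} (i : Fin 10) S R → lookup visitHandlers i ≡ keepᶜ
           → Run α (visit ⟪ toℕ i , 0 ⟫ ∷ₙ S) R 1 S (⟪ toℕ i , 0 ⟫ ∷ₙ R)
  run-atom i S R keep = step (step-visit i 0 S R (handledBy {i = i} keep (keep-eval ⟪ toℕ i , 0 ⟫ S R))) done

  run-node : ∀ {α} (i : Fin 10) f g → lookup visitHandlers i ≡ splitᶜ → Compiles α f → Compiles α g
           → ∀ S R → Run α (visit ⟪ toℕ i , ⟪ ⌜ f ⌝ , ⌜ g ⌝ ⟫ ⟫ ∷ₙ S) R (suc (stepCount f + (stepCount g + 1)))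
                         S (⟪ toℕ i , ⟪ ⌜ f ∘ᶜ K ⌝ , ⌜ g ∘ᶜ K ⌝ ⟫ ⟫ ∷ₙ R)
  run-node i f g split f↝ g↝ S R =
    step (step-visit i _ S R (handledBy {i = i} split (split-eval (toℕ i) ⌜ f ⌝ ⌜ g ⌝ S R)))
      (f↝ _ R ▷ g↝ _ _ ▷ step (step-assemble (toℕ i) S ⌜ f ∘ᶜ K ⌝ ⌜ g ∘ᶜ K ⌝ R) done)

  compiles : ∀ {α} c → Compiles α c
  compiles zer         S R = run-atom (# 0) S R refl
  compiles suc′        S R = run-atom (# 1) S R refl
  compiles idc         S R = run-atom (# 2) S R refl
  compiles orc         S R = step (step-visit (# 3) 0 S R (oracle-eval ⌜ orc ⌝ S R)) done
  compiles fstc        S R = run-atom (# 4) S R refl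
  compiles sndc        S R = run-atom (# 5) S R refl
  compiles (comp f g)      = run-node (# 6) f g refl (compiles f) (compiles g)
  compiles (pairc f g)     = run-node (# 7) f g refl (compiles f) (compiles g)
  compiles (rec f g)       = run-node (# 8) f g refl (compiles f) (compiles g)
  compiles (mu f)      S R =
    step (step-visit (# 9) ⌜ f ⌝ S R (splitμ-eval ⌜ f ⌝ S R))
      (compiles f _ R ▷ step (step-assembleμ S ⌜ f ∘ᶜ K ⌝ R) done)

  initᶜ iterateᶜ haltedᶜ composeIndexᶜ : Code
  initᶜ         = pairc (consᶜ (pairc zer idc) zer) zer
  iterateᶜ      = rec initᶜ (comp stepᶜ (comp sndc sndc))
  haltedᶜ       = comp fstc iterateᶜ
  composeIndexᶜ = comp (comp fstc predᶜ) (comp sndc (comp iterateᶜ (pairc idc (mu haltedᶜ))))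

  module _ {α : Baire} (N : ℕ) where
    Reaches : ℕ → ℕ → Set
    Reaches i state = Eval iterateᶜ α ⟪ N , i ⟫ state

    Running : ℕ → Set
    Running i = ∃ λ T → Eval haltedᶜ α ⟪ N , i ⟫ (suc T)

    reaches-≡ : ∀ {i i' state} → i ≡ i' → Reaches i state → Reaches i' state
    reaches-≡ refl r = r

    running-≡ : ∀ {i i'} → i ≡ i' → Running i → Running i'
    running-≡ refl r = r

    reaches-run : ∀ {i S R k S' R'} → Reaches i ⟪ S , R ⟫ → Run α S R k S' R'
                → Reaches (i + k) ⟪ S' , R' ⟫ × (∀ j → j < k → Running (i + j))
    reaches-run {i} r done = reaches-≡ (sym (+-identityʳ i)) r , λ _ ()
    reaches-run {i} {suc T} {R} {suc k} r (step d run)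
      with reaches-run {suc i} (rec-suc N i r (e-comp (e-comp (snd-eval N ⟪ i , _ ⟫) (snd-eval i _)) d)) run
    ... | r' , running = reaches-≡ (sym (+-suc i k)) r' , running′
      where
      running′ : ∀ j → j < suc k → Running (i + j)
      running′ zero    _         = running-≡ (sym (+-identityʳ i)) (T , e-comp r (fst-eval (suc T) R))
      running′ (suc j) (s≤s j<k) = running-≡ (sym (+-suc i j)) (running j j<k)

  composeIndexᶜ-eval : ∀ {α} c → Eval composeIndexᶜ α ⌜ c ⌝ ⌜ c ∘ᶜ K ⌝
  composeIndexᶜ-eval {α} c with reaches-run ⌜ c ⌝ {0} init (compiles c 0 0)
    where
    init : Reaches ⌜ c ⌝ 0 ⟪ visit ⌜ c ⌝ ∷ₙ 0 , 0 ⟫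
    init = rec-zero ⌜ c ⌝ (pair-eval (consᶜ-eval (pair-eval e-zer e-id) e-zer) e-zer)
  ... | final , running =
    e-comp (e-comp (e-comp (pair-eval e-id halts) final) (snd-eval 0 (σ ∷ₙ 0)))
           (e-comp (predᶜ-eval ⟪ σ , 0 ⟫) (fst-eval σ 0))
    where
    σ = ⌜ c ∘ᶜ K ⌝
    halts : Eval (mu haltedᶜ) α ⌜ c ⌝ (stepCount c)
    halts = e-mu {x = ⌜ c ⌝} {n = stepCount c} (e-comp final (fst-eval 0 (σ ∷ₙ 0))) running

ReducesVia : ∀ {A B C D} → Problem A B → Problem C D → Code → Code → Set
ReducesVia {A} {B} {C} {D} f g Φ Ψ = ∀ p x → Names A p x → Dom f x →
  ∃ λ y → Outputs C Φ p y × Dom g y ×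
    (∀ q y' → Names D q y' → Val g y y' → ∃ λ x' → Outputs B Ψ (join p q) x' × Val f x x')

≤W-refl : ∀ {A B} (f : Problem A B) → f ≤W f
≤W-refl f = orc , π₂ᶜ , λ p x p↦x dom →
  x , (p , (λ n → e-orc) , p↦x) , dom , λ q y q↦y fxy → y , (q , π₂ᶜ-join p q , q↦y) , fxy

≤W-tightening : ∀ {A B C D} (F G : Problem A B) {H : Problem C D}
              → (∀ {x} → Dom F x → Dom G x) → (∀ {x y} → Dom F x → Val G x y → Val F x y)
              → G ≤W H → F ≤W H
≤W-tightening F G dom-⊆ val-⊇ (Φ , Ψ , G≤H) = Φ , Ψ , λ p x p↦x Fx →
  let y , Φ↦y , Hy , back = G≤H p x p↦x (dom-⊆ Fx)
  in y , Φ↦y , Hy , λ q y' q↦y' Hyy' →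
       let x' , Ψ↦x' , Gxx' = back q y' q↦y' Hyy' in x' , Ψ↦x' , val-⊇ Fx Gxx'

detVal-index : ∀ {Y Z} (X : RepSpace) (f : Problem Y Z) {p y x} → Dom f y → DetVal X f p y x
             → ∃ λ c → ⌜ c ⌝ ≡ p 0
detVal-index {Z = Z} X f fy dv =
  let w , fyw = nonempty f fy
      z , z↦w = surjective Z w
      _ , univ , _ = dv z (w , fyw , z↦w)
      c , index , _ = univ 0
  in c , index

univNames-functional : ∀ (X : RepSpace) {p z x x'} → UnivNames X p z x → UnivNames X p z x' → _≈_ X x x'
univNames-functional X (s , univ , s↦x) (s' , univ' , s'↦x') =
  functional X s↦x (names-ext X (λ n → univ-deterministic (univ' n) (univ n)) s'↦x')

univNames-transfer : ∀ (X : RepSpace) {p s p' z x} → (∀ n m → Univ p s n m → Univ p' z n m)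
                   → UnivNames X p s x → UnivNames X p' z x
univNames-transfer X simulate (t , univ , t↦x) = t , (λ n → simulate n (t n) (univ n)) , t↦x

univ-∘ᶜ : ∀ {K p s p' z n m} → Computes K (join p' z) (join p s)
        → (∀ c → ⌜ c ⌝ ≡ p 0 → ⌜ c ∘ᶜ K ⌝ ≡ p' 0) → Univ p s n m → Univ p' z n m
univ-∘ᶜ {K} K↦ps index (c , c-index , d) = c ∘ᶜ K , index c c-index , ∘ᶜ-eval K↦ps d

module DetTranslation {Y Z U V A B P Q R : RepSpace}
  (X : RepSpace) (f : Problem Y Z) (g : Problem U V) (H : Problem A B) {f₁ : Problem Q R} {g₁ : Problem P Q}
  {Φf Ψf Φg Ψg Φh Ψh : Code}
  (f₁≤f : ReducesVia f₁ f Φf Ψf) (g₁≤g : ReducesVia g₁ g Φg Ψg) (H≤f₁g₁ : ReducesVia H (f₁ ∘ₚ g₁) Φh Ψh)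
  where

  -- Codes reading ⟨ r , q ⟩, where r names an instance (p , a) of Det X H and q a g-answer.
  aᶜ pᶜ w₁ᶜ yᶜ : Code
  aᶜ  = π₂ᶜ ∘ᶜ π₁ᶜ
  pᶜ  = π₁ᶜ ∘ᶜ π₁ᶜ
  w₁ᶜ = Ψg ∘ᶜ joinᶜ (Φh ∘ᶜ aᶜ) π₂ᶜ
  yᶜ  = Φf ∘ᶜ w₁ᶜ

  aᶜ-join : ∀ r q → Computes aᶜ (join r q) (π₂ r)
  aᶜ-join r q = computes-∘ᶜ (π₁ᶜ-join r q) (π₂ᶜ-computes r)

  pᶜ-join : ∀ r q → Computes pᶜ (join r q) (π₁ r)
  pᶜ-join r q = computes-∘ᶜ (π₁ᶜ-join r q) (π₁ᶜ-computes r)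

  -- Codes reading ⟨ p' , z ⟩ with p' = σ ∷ ⟨ r , q ⟩ and z a name of an f-answer; K computes
  -- ⟨ p , b-name ⟩, on which the program p 0 yields the answer of Det X H.
  restoreᶜ tᶜ bᶜ K : Code
  restoreᶜ = tailᶜ ∘ᶜ π₁ᶜ
  tᶜ = Ψf ∘ᶜ joinᶜ (w₁ᶜ ∘ᶜ restoreᶜ) π₂ᶜ
  bᶜ = Ψh ∘ᶜ joinᶜ (aᶜ ∘ᶜ restoreᶜ) tᶜ
  K  = joinᶜ (pᶜ ∘ᶜ restoreᶜ) bᶜ

  open ComposeIndex K using (composeIndexᶜ; composeIndexᶜ-eval)

  forwardᶜ backwardᶜ : Code
  forwardᶜ  = Φg ∘ᶜ (Φh ∘ᶜ π₂ᶜ)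
  backwardᶜ = joinᶜ (prependᶜ composeIndexᶜ) yᶜ

  DetTranslates : Carrier (BaireSpace ⊗ A) → Carrier (BaireSpace ⊗ Y) → Set
  DetTranslates (p , a) (p' , y) =
    Dom (Det X f) (p' , y) × (∀ x → Val (Det X f) (p' , y) x → Val (Det X H) (p , a) x)

  module Answer {r q p a x₀} (r↦p : π₁ r ≗ p) (Ha : Dom H a) (dv₀ : DetVal X H p a x₀)
    {w₁ s_w₁} (w₁ᶜ↦ : Computes w₁ᶜ (join r q) s_w₁)
    (backH : ∀ s t → Names R s t → Val f₁ w₁ t → ∃ λ b → Outputs B Ψh (join (π₂ r) s) b × Val H a b)
    {y s_y} (yᶜ↦ : Computes yᶜ (join r q) s_y) (s_y↦y : Names Y s_y y) (fy : Dom f y)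
    (backF : ∀ z w → Names Z z w → Val f y w → ∃ λ t → Outputs R Ψf (join s_w₁ z) t × Val f₁ w₁ t)
    where

    α : Baire
    α = join r q

    c₀ : Code
    c₀ = proj₁ (detVal-index X H Ha dv₀)

    c₀-index : ⌜ c₀ ⌝ ≡ p 0
    c₀-index = proj₂ (detVal-index X H Ha dv₀)

    σ : ℕ
    σ = ⌜ c₀ ∘ᶜ K ⌝

    p' : Baire
    p' = prepend σ α

    prependᶜ-σ : Computes (prependᶜ composeIndexᶜ) α p'
    prependᶜ-σ = prependᶜ-computes
      (subst (λ n → Eval composeIndexᶜ α n σ) (trans c₀-index (sym (r↦p 0)))
             (composeIndexᶜ-eval c₀))

    simulation : ∀ z w → Names Z z w → Val f y w →
      ∃ λ b → Val H a b × ∃ λ s_b → Names B s_b b × Computes K (join p' z) (join p s_b)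
    simulation z w z↦w fyw =
      let t , (s_t , Ψf↦s_t , s_t↦t) , f₁w₁t = backF z w z↦w fyw
          b , (s_b , Ψh↦s_b , s_b↦b) , Hab  = backH s_t t s_t↦t f₁w₁t
          restore = computes-∘ᶜ (π₁ᶜ-join p' z) (tailᶜ-computes p')
          tᶜ↦ = computes-∘ᶜ (joinᶜ-computes (computes-∘ᶜ restore w₁ᶜ↦) (π₂ᶜ-join p' z)) Ψf↦s_t
          bᶜ↦ = computes-∘ᶜ (joinᶜ-computes (computes-∘ᶜ restore (aᶜ-join r q)) tᶜ↦) Ψh↦s_b
      in b , Hab , s_b , s_b↦b ,
         joinᶜ-computes (computes-∘ᶜ restore (computes-resp r↦p (pᶜ-join r q))) bᶜ↦

    index-∘ᶜK : ∀ c → ⌜ c ⌝ ≡ p 0 → ⌜ c ∘ᶜ K ⌝ ≡ p' 0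
    index-∘ᶜK c c-index with ⌜⌝-injective {c} {c₀} (trans c-index (sym c₀-index))
    ... | refl = refl

    detVal-p' : DetVal X f p' y x₀
    detVal-p' z (w , fyw , z↦w) =
      let b , Hab , s_b , s_b↦b , K↦ = simulation z w z↦w fyw
      in univNames-transfer X (λ n m → univ-∘ᶜ K↦ index-∘ᶜK) (dv₀ s_b (b , Hab , s_b↦b))

    translates : DetTranslates (p , a) (p' , y)
    translates = (fy , x₀ , detVal-p') , λ x dv →
      let w , fyw = nonempty f fy
          z , z↦w = surjective Z w
          x₀≈x = univNames-functional X (detVal-p' z (w , fyw , z↦w)) (dv z (w , fyw , z↦w))
      in val-resp (Det X H) (IsEquivalence.refl (≈-equiv (BaireSpace ⊗ A))) x₀≈x dv₀

    answer : ∃ λ py → Outputs (BaireSpace ⊗ Y) backwardᶜ α py × DetTranslates (p , a) py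
    answer = (p' , y) , (join p' s_y , joinᶜ-computes prependᶜ-σ yᶜ↦ , join-π₁ p' s_y ,
                         names-ext Y (λ n → sym (join-π₂ p' s_y n)) s_y↦y) , translates

  detTranslation-reduction : ∀ r pa → Names (BaireSpace ⊗ A) r pa → Dom (Det X H) pa →
    ∃ λ u → Outputs U forwardᶜ r u × Dom g u ×
      (∀ q w → Names V q w → Val g u w →
         ∃ λ py → Outputs (BaireSpace ⊗ Y) backwardᶜ (join r q) py × DetTranslates pa py)
  detTranslation-reduction r (p , a) (r↦p , r↦a) (Ha , x₀ , dv₀) =
    let v , (s_v , Φh↦s_v , s_v↦v) , (g₁v , f₁-dom) , backH = H≤f₁g₁ (π₂ r) a r↦a Ha
        u , (s_u , Φg↦s_u , s_u↦u) , gu , backG = g₁≤g s_v v s_v↦v g₁v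
    in u , (s_u , computes-∘ᶜ (computes-∘ᶜ (π₂ᶜ-computes r) Φh↦s_v) Φg↦s_u , s_u↦u) , gu ,
       λ q w q↦w guw →
         let w₁ , (s_w₁ , Ψg↦s_w₁ , s_w₁↦w₁) , g₁vw₁ = backG q w q↦w guw
             y , (s_y , Φf↦s_y , s_y↦y) , fy , backF = f₁≤f s_w₁ w₁ s_w₁↦w₁ (f₁-dom w₁ g₁vw₁)
             w₁ᶜ↦ : Computes w₁ᶜ (join r q) s_w₁
             w₁ᶜ↦ = computes-∘ᶜ (joinᶜ-computes (computes-∘ᶜ (aᶜ-join r q) Φh↦s_v)
                                                (π₂ᶜ-join r q))
                                Ψg↦s_w₁
         in Answer.answer r↦p Ha dv₀ w₁ᶜ↦ (λ s t s↦t f₁w₁t → backH s t s↦t (w₁ , g₁vw₁ , f₁w₁t))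
                          (computes-∘ᶜ w₁ᶜ↦ Φf↦s_y) s_y↦y fy backF

  detTranslation : Problem (BaireSpace ⊗ A) (BaireSpace ⊗ Y)
  detTranslation = record
    { Dom      = Dom (Det X H)
    ; Val      = DetTranslates
    ; nonempty = λ {pa} domDet →
        let r , r↦pa = surjective (BaireSpace ⊗ A) pa
            u , _ , gu , back = detTranslation-reduction r pa r↦pa domDet
            w , guw = nonempty g gu
            q , q↦w = surjective V w
            py , _ , translates = back q w q↦w guw
        in py , translates
    ; dom-resp = dom-resp (Det X H)
    ; val-resp = λ pa≈ py≈ (dom , sound) →
        dom-resp (Det X f) py≈ dom ,
        λ x dv → val-resp (Det X H) pa≈ (IsEquivalence.refl (≈-equiv X))
                   (sound x (val-resp (Det X f) (IsEquivalence.sym (≈-equiv (BaireSpace ⊗ Y)) py≈)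
                                                (IsEquivalence.refl (≈-equiv X)) dv))
    }

  detTranslation≤g : detTranslation ≤W g
  detTranslation≤g = forwardᶜ , backwardᶜ , detTranslation-reduction

mainTheorem2 : ∀ {Y Z U V A B C D} (X : RepSpace) (f : Problem Y Z) (g : Problem U V)
                 (H : Problem A B) (H' : Problem C D)
               → IsCompProd f g H → IsCompProd (Det X f) g H'
               → Det X H ≤W H'
mainTheorem2 X f g H H' (_ , _ , _ , _ , f₁ , g₁ , (_ , _ , f₁≤f) , (_ , _ , g₁≤g) , (_ , _ , H≤f₁g₁))
             (composite≤H' , _) =
  ≤W-tightening (Det X H) (Det X f ∘ₚ detTranslation) {H'} (λ domDet → domDet , λ _ → proj₁)
    (λ _ (_ , translates , dv) → proj₂ translates _ dv)
    (composite≤H' (Det X f) detTranslation (≤W-refl (Det X f)) detTranslation≤g)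
  where open DetTranslation X f g H {f₁ = f₁} {g₁ = g₁} f₁≤f g₁≤g H≤f₁g₁
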